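{- Fix integers $2\le r\le k$. There is a constant $C=C(k,r)$ such that for every $n$, every $r$-cut of the complete $k$-uniform hypergraph $K_n^{(k)}$ has excess at most $Cn^{k-1}$.
   Context: $K_n^{(k)}$ is the $k$-uniform hypergraph on $n$ vertices whose edges are all $k$-subsets. An $r$-cut is a partition of the vertex set into $r$ labelled parts; its size is the number of edges having a vertex in every part; its excess is its size minus $\frac{S(k,r)r!}{r^k}m$, where $m$ is the number of edges and $S(k,r)$ is the Stirling number of the second kind. -}

module Defs where

open import Data.Nat using (ℕ; zero; suc; _*_; _^_; _≟_)
open import Data.Nat.Properties using (m^n≢0)
open import Data.Nat using (_!)
open import Data.Bool using (true; false)
open import Data.Fin using (Fin)
open import Data.Fin.Subset using (Subset; _∈_; ∣_∣)
open import Data.Fin.Subset.Properties using (_∈?_)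
open import Data.Fin.Properties using (any?; all?)
open import Data.Fin.Properties renaming (_≟_ to _≟ᶠ_) using ()
open import Data.Vec using ([]; _∷_)
open import Data.List using (List; []; _∷_; map; _++_; filter; length)
open import Data.Product using (∃; _×_)
open import Relation.Nullary using (Dec)
open import Relation.Nullary.Decidable using (_×-dec_)
open import Relation.Binary.PropositionalEquality using (_≡_)
open import Data.Integer using (+_)
open import Data.Rational using (ℚ; _/_; _-_)
import Data.Rational as ℚ

stirling₂ : ℕ → ℕ → ℕ
stirling₂ zero    zero    = 1
stirling₂ zero    (suc k) = 0
stirling₂ (suc n) zero    = 0
stirling₂ (suc n) (suc k) = suc k * stirling₂ n (suc k) + stirling₂ n k
  where open Data.Nat using (_+_)

allSubsets : (n : ℕ) → List (Subset n)
allSubsets zero    = [] ∷ []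
allSubsets (suc n) = map (true ∷_) (allSubsets n) ++ map (false ∷_) (allSubsets n)

edges : (n k : ℕ) → List (Subset n)
edges n k = filter (λ e → ∣ e ∣ ≟ k) (allSubsets n)

numEdges : (n k : ℕ) → ℕ
numEdges n k = length (edges n k)

-- an r-cut: partition of the vertices into r labelled (possibly empty) parts
Cut : (n r : ℕ) → Set
Cut n r = Fin n → Fin r

Crossing : ∀ {n r} → Cut n r → Subset n → Set
Crossing {n} {r} c e = (j : Fin r) → ∃ λ (v : Fin n) → (v ∈ e) × (c v ≡ j)

crossing? : ∀ {n r} (c : Cut n r) (e : Subset n) → Dec (Crossing c e)
crossing? c e = all? (λ j → any? (λ v → (v ∈? e) ×-dec (c v ≟ᶠ j)))

cutSize : ∀ {n r} (k : ℕ) → Cut n r → ℕ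
cutSize {n} k c = length (filter (crossing? c) (edges n k))

-- S(k,r) r! m / r^k  (r = 0 never occurs in the theorem; value irrelevant there)
expectedSize : (n k r : ℕ) → ℚ
expectedSize n k zero    = ℚ.0ℚ
expectedSize n k (suc r) =
  (+ (stirling₂ k (suc r) * (suc r) ! * numEdges n k) / (suc r ^ k)) {{m^n≢0 (suc r) k}}

excess : ∀ {n r} (k : ℕ) → Cut n r → ℚ
excess {n} {r} k c = (+ cutSize k c / 1) - expectedSize n k r

-- Count ordered tuples instead of sets.  If the parts of an r-cut have sizes a₁, …, a_r, then
-- k! times the number of crossing edges is at most the number of length-k words over the
-- vertices that meet every part, namely k! [t^k] ∏ⱼ (e^{aⱼ t} − 1).  Moving two part sizes
-- towards each other with their sum fixed only increases this coefficient (x ↦ x^s is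
-- convex), so it is largest for equal parts n/r, where it equals (n/r)^k r! S(k,r).
-- Since k! m = n(n−1)⋯(n−k+1) ≥ n^k − C(k,2) n^{k−1}, the cut has at most
-- S(k,r) r! m / r^k + S(k,r) r! C(k,2) n^{k−1} edges.

module Submission where

open import Data.Bool using (Bool; true; false; T; not; _∧_; if_then_else_)
open import Data.Empty using (⊥; ⊥-elim)
open import Data.Fin using (Fin; zero; suc) renaming (_≟_ to _≟ᶠ_)
open import Data.Fin.Subset using (Subset; _∈_; ∣_∣)
open import Data.Fin.Subset.Properties using (drop-there)
import Data.Integer as ℤ
import Data.Integer.Properties as ℤ
import Data.Integer.Tactic.RingSolver as ℤ
open import Data.List using (List; []; _∷_; _++_; filter; length)
import Data.List as List
open import Data.Nat
open import Data.Nat.Properties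
open import Data.Nat.Tactic.RingSolver using (solve-∀)
open import Algebra.Properties.CommutativeSemigroup +-commutativeSemigroup
  using (interchange; x∙yz≈y∙xz; xy∙z≈y∙xz)
open import Data.Product using (∃; _×_; _,_)
open import Data.Rational as ℚ using (ℚ; toℚᵘ)
import Data.Rational.Properties as ℚ
open import Data.Rational.Unnormalised as ℚᵘ using (mkℚᵘ; *≤*) renaming (_≃_ to _≃ᵘ_)
import Data.Rational.Unnormalised.Properties as ℚᵘ
open import Data.Sum using (_⊎_; inj₁; inj₂)
open import Data.Vec using (Vec; []; _∷_; _[_]≔_; _[_]%=_; replicate; lookup; sum)
import Data.Vec as Vec
open import Data.Vec.Properties using (lookup∘update; lookup∘update′; map-replicate)
open import Function using (_∘_)
open import Level using (0ℓ)
open import Relation.Binary using (tri<; tri≈; tri>)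
open import Relation.Binary.PropositionalEquality
open import Relation.Nullary using (yes; no; does)
open import Relation.Nullary.Decidable using (toWitness; isYes≗does)
open import Relation.Unary using (Pred; Decidable)

open import Defs using (stirling₂; allSubsets; edges; numEdges; Cut; crossing?; cutSize; excess)

Seq : Set
Seq = ℕ → ℕ

infix 4 _≤̇_
_≤̇_ : Seq → Seq → Set
f ≤̇ g = ∀ i → f i ≤ g i

sumUpTo : ℕ → Seq → ℕ
sumUpTo zero    f = f 0
sumUpTo (suc k) f = sumUpTo k f + f (suc k)

sumUpTo-cong : ∀ k {f g : Seq} → (∀ i → i ≤ k → f i ≡ g i) → sumUpTo k f ≡ sumUpTo k g
sumUpTo-cong zero    f≡g = f≡g 0 z≤n
sumUpTo-cong (suc k) f≡g =
  cong₂ _+_ (sumUpTo-cong k (λ i i≤k → f≡g i (m≤n⇒m≤1+n i≤k))) (f≡g (suc k) ≤-refl)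

sumUpTo-mono-≤ : ∀ k {f g : Seq} → f ≤̇ g → sumUpTo k f ≤ sumUpTo k g
sumUpTo-mono-≤ zero    f≤g = f≤g 0
sumUpTo-mono-≤ (suc k) f≤g = +-mono-≤ (sumUpTo-mono-≤ k f≤g) (f≤g (suc k))

sumUpTo-distrib-+ : ∀ k (f g : Seq) → sumUpTo k (λ i → f i + g i) ≡ sumUpTo k f + sumUpTo k g
sumUpTo-distrib-+ zero    f g = refl
sumUpTo-distrib-+ (suc k) f g = begin
  sumUpTo k (λ i → f i + g i) + (f (suc k) + g (suc k))
    ≡⟨ cong (_+ (f (suc k) + g (suc k))) (sumUpTo-distrib-+ k f g) ⟩
  sumUpTo k f + sumUpTo k g + (f (suc k) + g (suc k))
    ≡⟨ interchange (sumUpTo k f) (sumUpTo k g) (f (suc k)) (g (suc k)) ⟩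
  sumUpTo k f + f (suc k) + (sumUpTo k g + g (suc k)) ∎
  where open ≡-Reasoning

sumUpTo-*ˡ : ∀ k c (f : Seq) → sumUpTo k (λ i → c * f i) ≡ c * sumUpTo k f
sumUpTo-*ˡ zero    c f = refl
sumUpTo-*ˡ (suc k) c f = begin
  sumUpTo k (λ i → c * f i) + c * f (suc k) ≡⟨ cong (_+ c * f (suc k)) (sumUpTo-*ˡ k c f) ⟩
  c * sumUpTo k f + c * f (suc k)           ≡⟨ *-distribˡ-+ c (sumUpTo k f) (f (suc k)) ⟨
  c * (sumUpTo k f + f (suc k))             ∎
  where open ≡-Reasoning

sumUpTo-unfoldˡ : ∀ k (f : Seq) → sumUpTo (suc k) f ≡ f 0 + sumUpTo k (f ∘ suc)
sumUpTo-unfoldˡ zero    f = refl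
sumUpTo-unfoldˡ (suc k) f =
  trans (cong (_+ f (2 + k)) (sumUpTo-unfoldˡ k f)) (+-assoc (f 0) _ _)

sumUpTo-zero : ∀ k → sumUpTo k (λ _ → 0) ≡ 0
sumUpTo-zero zero    = refl
sumUpTo-zero (suc k) = trans (+-identityʳ _) (sumUpTo-zero k)

choose : ℕ → ℕ → ℕ
choose n       zero    = 1
choose zero    (suc k) = 0
choose (suc n) (suc k) = choose n k + choose n (suc k)

choose-< : ∀ {n k} → n < k → choose n k ≡ 0
choose-< {zero}  {suc k} _         = refl
choose-< {suc n} {suc k} (s≤s n<k) = cong₂ _+_ (choose-< n<k) (choose-< (m<n⇒m<1+n n<k))

choose-1 : ∀ n → choose n 1 ≡ n
choose-1 zero    = refl
choose-1 (suc n) = cong suc (choose-1 n)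

choose-absorb : ∀ k i → suc i * choose (suc k) (suc i) ≡ suc k * choose k i
choose-absorb zero    zero    = refl
choose-absorb zero    (suc i) = *-zeroʳ (2 + i)
choose-absorb (suc k) zero    =
  trans (+-identityʳ _) (trans (cong suc (choose-1 (suc k))) (sym (*-identityʳ (2 + k))))
choose-absorb (suc k) (suc i) = begin
  (2 + i) * (choose (suc k) (suc i) + choose (suc k) (2 + i))
    ≡⟨ *-distribˡ-+ (2 + i) (choose (suc k) (suc i)) _ ⟩
  choose (suc k) (suc i) + suc i * choose (suc k) (suc i) + (2 + i) * choose (suc k) (2 + i)
    ≡⟨ cong₂ (λ a b → choose (suc k) (suc i) + a + b) (choose-absorb k i) (choose-absorb k (suc i)) ⟩
  choose (suc k) (suc i) + suc k * choose k i + suc k * choose k (suc i)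
    ≡⟨ +-assoc (choose (suc k) (suc i)) _ _ ⟩
  choose (suc k) (suc i) + (suc k * choose k i + suc k * choose k (suc i))
    ≡⟨ cong (choose (suc k) (suc i) +_) (*-distribˡ-+ (suc k) (choose k i) _) ⟨
  (2 + k) * choose (suc k) (suc i) ∎
  where open ≡-Reasoning

^-bernoulli : ∀ a j → a ^ suc j + suc j * a ^ j ≤ suc a ^ suc j
^-bernoulli a zero    = ≤-reflexive (base a)
  where base : ∀ a → a * 1 + 1 * 1 ≡ (1 + a) * 1
        base = solve-∀
^-bernoulli a (suc j) = begin
  a ^ (2 + j) + (2 + j) * a ^ suc j              ≡⟨ expand a (a ^ j) j ⟩
  a * (a * b) + (a * b + a * (suc j * b))
    ≤⟨ +-monoʳ-≤ (a * (a * b)) (+-monoʳ-≤ (a * b) (m≤n+m _ (suc j * b))) ⟩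
  a * (a * b) + (a * b + (suc j * b + a * (suc j * b))) ≡⟨ factor a b j ⟩
  suc a * (a ^ suc j + suc j * a ^ j)            ≤⟨ *-monoʳ-≤ (suc a) (^-bernoulli a j) ⟩
  suc a ^ (2 + j)                                ∎
  where
  open ≤-Reasoning
  b = a ^ j
  expand : ∀ a b j → a * (a * b) + (2 + j) * (a * b) ≡ a * (a * b) + (a * b + a * ((1 + j) * b))
  expand = solve-∀
  factor : ∀ a b j → a * (a * b) + (a * b + ((1 + j) * b + a * ((1 + j) * b))) ≡ (1 + a) * (a * b + (1 + j) * b)
  factor = solve-∀

^-distribʳ-* : ∀ m x i → (m * x) ^ i ≡ m ^ i * x ^ i
^-distribʳ-* m x zero    = refl
^-distribʳ-* m x (suc i) = trans (cong ((m * x) *_) (^-distribʳ-* m x i)) (interchange′ m x (m ^ i) (x ^ i))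
  where interchange′ : ∀ a b c d → a * b * (c * d) ≡ a * c * (b * d)
        interchange′ = solve-∀

^-supermodular : ∀ m z d e → (z + d) ^ m + (z + e) ^ m ≤ (z + d + e) ^ m + z ^ m
^-supermodular zero    z d e = ≤-refl
^-supermodular (suc m) z d e = begin
  (z + d) * A + (z + e) * B           ≡⟨ expand z d e A B ⟩
  z * (A + B) + d * A + e * B
    ≤⟨ +-mono-≤ (+-mono-≤ (*-monoʳ-≤ z (^-supermodular m z d e)) (*-monoʳ-≤ d A≤D)) (*-monoʳ-≤ e B≤D) ⟩
  z * (D + Z) + d * D + e * D         ≡⟨ collect z d e D Z ⟩
  (z + d + e) * D + z * Z             ∎
  where
  open ≤-Reasoning
  A = (z + d) ^ m
  B = (z + e) ^ m
  D = (z + d + e) ^ m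
  Z = z ^ m
  A≤D : A ≤ D
  A≤D = ^-monoˡ-≤ m (m≤m+n (z + d) e)
  B≤D : B ≤ D
  B≤D = ^-monoˡ-≤ m (subst (z + e ≤_) (sym (+-assoc z d e)) (+-monoʳ-≤ z (m≤n+m e d)))
  expand : ∀ z d e A B → (z + d) * A + (z + e) * B ≡ z * (A + B) + d * A + e * B
  expand = solve-∀
  collect : ∀ z d e D Z → z * (D + Z) + d * D + e * D ≡ (z + d + e) * D + z * Z
  collect = solve-∀

^-balance : ∀ {x y n y′} s → x ≤ n → n ≤ y → x + y ≡ n + y′ → n ^ s + y′ ^ s ≤ x ^ s + y ^ s
^-balance {x} s x≤n n≤y eq
  with d , refl ← m≤n⇒∃[o]m+o≡n x≤n
  with e , refl ← m≤n⇒∃[o]m+o≡n n≤y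
  with refl ← +-cancelˡ-≡ (x + d) _ (x + e) (trans (sym eq) (x∙yz≈y∙xz x (x + d) e))
  = subst ((x + d) ^ s + (x + e) ^ s ≤_) (+-comm ((x + d + e) ^ s) (x ^ s)) (^-supermodular s x d e)

Between : ℕ → ℕ → ℕ → Set
Between x y n = (x ≤ n × n ≤ y) ⊎ (y ≤ n × n ≤ x)

Between⇒≤+ : ∀ {x y n} → Between x y n → n ≤ x + y
Between⇒≤+ {x} {y} (inj₁ (_ , n≤y)) = ≤-trans n≤y (m≤n+m y x)
Between⇒≤+ {x} {y} (inj₂ (_ , n≤x)) = ≤-trans n≤x (m≤m+n x y)

Between⇒^-balance : ∀ {x y n y′} → Between x y n → x + y ≡ n + y′ → ∀ s → n ^ s + y′ ^ s ≤ x ^ s + y ^ s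
Between⇒^-balance (inj₁ (x≤n , n≤y)) eq s = ^-balance s x≤n n≤y eq
Between⇒^-balance {x} {y} {n} {y′} (inj₂ (y≤n , n≤x)) eq s =
  subst (n ^ s + y′ ^ s ≤_) (+-comm (y ^ s) (x ^ s)) (^-balance s y≤n n≤x (trans (+-comm y x) eq))

m<n∧m+a≡n+b⇒b<a : ∀ {m n a b} → m < n → m + a ≡ n + b → b < a
m<n∧m+a≡n+b⇒b<a {n = n} {a} {b} m<n eq = +-cancelˡ-< n b a (subst (_< n + a) eq (+-monoˡ-< a m<n))

m<n∧n+a<m+b⇒a<b : ∀ {m n a b} → m < n → n + a < m + b → a < b
m<n∧n+a<m+b⇒a<b {n = n} {a} {b} m<n lt = +-cancelˡ-< n a b (<-trans lt (+-monoˡ-< b m<n))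

sum-[]≔ : ∀ {L} (bs : Vec ℕ L) i v → sum (bs [ i ]≔ v) + lookup bs i ≡ sum bs + v
sum-[]≔ (y ∷ bs) zero    v = swap v (sum bs) y
  where swap : ∀ a b c → a + b + c ≡ c + b + a
        swap = solve-∀
sum-[]≔ (z ∷ bs) (suc i) v = begin
  z + sum (bs [ i ]≔ v) + lookup bs i  ≡⟨ +-assoc z _ _ ⟩
  z + (sum (bs [ i ]≔ v) + lookup bs i) ≡⟨ cong (z +_) (sum-[]≔ bs i v) ⟩
  z + (sum bs + v)                      ≡⟨ +-assoc z _ _ ⟨
  z + sum bs + v                        ∎
  where open ≡-Reasoning

sum-[]≔-exchange : ∀ {L} x n (bs : Vec ℕ L) i {y′ t} →
                   x + sum bs ≡ n + t → x + lookup bs i ≡ n + y′ → sum (bs [ i ]≔ y′) ≡ t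
sum-[]≔-exchange x n bs i {y′} {t} total pair = +-cancelʳ-≡ (n + y′) _ t (begin
  sum cs + (n + y′)        ≡⟨ cong (sum cs +_) pair ⟨
  sum cs + (x + y)         ≡⟨ x∙yz≈y∙xz (sum cs) x y ⟩
  x + (sum cs + y)         ≡⟨ cong (x +_) (sum-[]≔ bs i y′) ⟩
  x + (sum bs + y′)        ≡⟨ +-assoc x (sum bs) y′ ⟨
  x + sum bs + y′          ≡⟨ cong (_+ y′) total ⟩
  n + t + y′               ≡⟨ xy∙z≈y∙xz n t y′ ⟩
  t + (n + y′)             ∎)
  where open ≡-Reasoning
        y  = lookup bs i
        cs = bs [ i ]≔ y′

sum-[]%=suc : ∀ {r} (a : Vec ℕ r) p → sum (a [ p ]%= suc) ≡ suc (sum a)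
sum-[]%=suc (x ∷ a) zero    = refl
sum-[]%=suc (x ∷ a) (suc p) = trans (cong (x +_) (sum-[]%=suc a p)) (+-suc x (sum a))

sum-replicate-0 : ∀ r → sum (replicate r 0) ≡ 0
sum-replicate-0 zero    = refl
sum-replicate-0 (suc r) = sum-replicate-0 r

sum-map-* : ∀ {L} m (a : Vec ℕ L) → sum (Vec.map (m *_) a) ≡ m * sum a
sum-map-* m []      = sym (*-zeroʳ m)
sum-map-* m (x ∷ a) = trans (cong (m * x +_) (sum-map-* m a)) (sym (*-distribˡ-+ m x (sum a)))

replicate≡map-* : ∀ r n → replicate r n ≡ Vec.map (n *_) (replicate r 1)
replicate≡map-* r n = trans (cong (replicate r) (sym (*-identityʳ n))) (sym (map-replicate (n *_) 1 r))

-- Exponential generating functions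

-- A sequence f stands for its exponential generating function Σ f i tⁱ/i!: ⊛ is the product,
-- ∂ the derivative, mulX multiplication by t, and dilate m the substitution t ↦ m t.
infixl 7 _⊛_
_⊛_ : Seq → Seq → Seq
(f ⊛ g) k = sumUpTo k (λ i → choose k i * f i * g (k ∸ i))

∂ : Seq → Seq
∂ f = f ∘ suc

infixl 6 _⊕_
_⊕_ : Seq → Seq → Seq
(f ⊕ g) i = f i + g i

infixr 8 _·_
_·_ : ℕ → Seq → Seq
(c · f) i = c * f i

δ : Seq
δ zero    = 1
δ (suc _) = 0

mulX : Seq → Seq
mulX f zero    = 0
mulX f (suc i) = suc i * f i

dilate : ℕ → Seq → Seq
dilate m f i = m ^ i * f i

⊛-leibniz : ∀ f g k → (f ⊛ g) (suc k) ≡ (∂ f ⊛ g) k + (f ⊛ ∂ g) k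
⊛-leibniz f g k = begin
  (f ⊛ g) (suc k)
    ≡⟨ sumUpTo-unfoldˡ k _ ⟩
  1 * f 0 * g (suc k) + sumUpTo k (λ i → (choose k i + choose k (suc i)) * f (suc i) * g (k ∸ i))
    ≡⟨ cong (1 * f 0 * g (suc k) +_) (trans (sumUpTo-cong k (λ i _ → pascal-split i)) (sumUpTo-distrib-+ k _ _)) ⟩
  1 * f 0 * g (suc k) + ((∂ f ⊛ g) k + shifted)
    ≡⟨ x∙yz≈y∙xz (1 * f 0 * g (suc k)) ((∂ f ⊛ g) k) shifted ⟩
  (∂ f ⊛ g) k + (1 * f 0 * g (suc k) + shifted)
    ≡⟨ cong ((∂ f ⊛ g) k +_) head+shifted ⟩
  (∂ f ⊛ g) k + (f ⊛ ∂ g) k ∎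
  where
  open ≡-Reasoning
  term : Seq
  term i = choose k i * f i * g (suc k ∸ i)
  shifted : ℕ
  shifted = sumUpTo k (term ∘ suc)
  pascal-split : ∀ i → (choose k i + choose k (suc i)) * f (suc i) * g (k ∸ i)
                     ≡ choose k i * f (suc i) * g (k ∸ i) + term (suc i)
  pascal-split i = trans (cong (_* g (k ∸ i)) (*-distribʳ-+ (f (suc i)) (choose k i) _))
                         (*-distribʳ-+ (g (k ∸ i)) (choose k i * f (suc i)) _)
  head+shifted : 1 * f 0 * g (suc k) + shifted ≡ (f ⊛ ∂ g) k
  head+shifted = begin
    term 0 + shifted          ≡⟨ sumUpTo-unfoldˡ k term ⟨
    sumUpTo k term + term (suc k)
      ≡⟨ cong (λ c → sumUpTo k term + c * f (suc k) * g (k ∸ k)) (choose-< (n<1+n k)) ⟩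
    sumUpTo k term + 0        ≡⟨ +-identityʳ _ ⟩
    sumUpTo k term
      ≡⟨ sumUpTo-cong k (λ i i≤k → cong (λ j → choose k i * f i * g j) (+-∸-assoc 1 i≤k)) ⟩
    (f ⊛ ∂ g) k               ∎

⊛-cong : ∀ {f f′ g g′} → f ≗ f′ → g ≗ g′ → f ⊛ g ≗ f′ ⊛ g′
⊛-cong f≗ g≗ k = sumUpTo-cong k (λ i _ → cong₂ (λ a b → choose k i * a * b) (f≗ i) (g≗ (k ∸ i)))

⊛-congˡ : ∀ {f f′} → f ≗ f′ → ∀ g → f ⊛ g ≗ f′ ⊛ g
⊛-congˡ f≗ g = ⊛-cong {g = g} f≗ (λ _ → refl)

⊛-congʳ : ∀ f {g g′} → g ≗ g′ → f ⊛ g ≗ f ⊛ g′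
⊛-congʳ f g≗ = ⊛-cong {f = f} (λ _ → refl) g≗

⊛-monoˡ-≤ : ∀ {f f′} g → f ≤̇ f′ → f ⊛ g ≤̇ f′ ⊛ g
⊛-monoˡ-≤ g f≤ k = sumUpTo-mono-≤ k (λ i → *-monoˡ-≤ (g (k ∸ i)) (*-monoʳ-≤ (choose k i) (f≤ i)))

⊛-monoʳ-≤ : ∀ f {g g′} → g ≤̇ g′ → f ⊛ g ≤̇ f ⊛ g′
⊛-monoʳ-≤ f g≤ k = sumUpTo-mono-≤ k (λ i → *-monoʳ-≤ (choose k i * f i) (g≤ (k ∸ i)))

⊛-distribʳ-⊕ : ∀ f g h → (f ⊕ g) ⊛ h ≗ f ⊛ h ⊕ g ⊛ h
⊛-distribʳ-⊕ f g h k =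
  trans (sumUpTo-cong k (λ i _ → distrib (choose k i) (f i) (g i) (h (k ∸ i)))) (sumUpTo-distrib-+ k _ _)
  where distrib : ∀ a b c d → a * (b + c) * d ≡ a * b * d + a * c * d
        distrib = solve-∀

⊛-distribˡ-⊕ : ∀ f g h → f ⊛ (g ⊕ h) ≗ f ⊛ g ⊕ f ⊛ h
⊛-distribˡ-⊕ f g h k =
  trans (sumUpTo-cong k (λ i _ → *-distribˡ-+ (choose k i * f i) (g (k ∸ i)) (h (k ∸ i))))
        (sumUpTo-distrib-+ k _ _)

·-⊛ : ∀ c f g → c · f ⊛ g ≗ c · (f ⊛ g)
·-⊛ c f g k = trans (sumUpTo-cong k (λ i _ → pull (choose k i) c (f i) (g (k ∸ i)))) (sumUpTo-*ˡ k c _)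
  where pull : ∀ a b c d → a * (b * c) * d ≡ b * (a * c * d)
        pull = solve-∀

⊛-· : ∀ c f g → f ⊛ c · g ≗ c · (f ⊛ g)
⊛-· c f g k = trans (sumUpTo-cong k (λ i _ → pull (choose k i) c (f i) (g (k ∸ i)))) (sumUpTo-*ˡ k c _)
  where pull : ∀ a b c d → a * c * (b * d) ≡ b * (a * c * d)
        pull = solve-∀

⊛-comm : ∀ f g → f ⊛ g ≗ g ⊛ f
⊛-comm f g zero    = swap (f 0) (g 0)
  where swap : ∀ a b → 1 * a * b ≡ 1 * b * a
        swap = solve-∀
⊛-comm f g (suc k) = begin
  (f ⊛ g) (suc k)               ≡⟨ ⊛-leibniz f g k ⟩
  (∂ f ⊛ g) k + (f ⊛ ∂ g) k     ≡⟨ cong₂ _+_ (⊛-comm (∂ f) g k) (⊛-comm f (∂ g) k) ⟩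
  (g ⊛ ∂ f) k + (∂ g ⊛ f) k     ≡⟨ +-comm ((g ⊛ ∂ f) k) _ ⟩
  (∂ g ⊛ f) k + (g ⊛ ∂ f) k     ≡⟨ ⊛-leibniz g f k ⟨
  (g ⊛ f) (suc k)               ∎
  where open ≡-Reasoning

⊛-assoc : ∀ f g h → f ⊛ (g ⊛ h) ≗ (f ⊛ g) ⊛ h
⊛-assoc f g h zero    = reassoc (f 0) (g 0) (h 0)
  where reassoc : ∀ a b c → 1 * a * (1 * b * c) ≡ 1 * (1 * a * b) * c
        reassoc = solve-∀
⊛-assoc f g h (suc k) = begin
  (f ⊛ (g ⊛ h)) (suc k)
    ≡⟨ ⊛-leibniz f (g ⊛ h) k ⟩
  (∂ f ⊛ (g ⊛ h)) k + (f ⊛ ∂ (g ⊛ h)) k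
    ≡⟨ cong ((∂ f ⊛ (g ⊛ h)) k +_) (trans (⊛-congʳ f (⊛-leibniz g h) k)
                                          (⊛-distribˡ-⊕ f (∂ g ⊛ h) (g ⊛ ∂ h) k)) ⟩
  (∂ f ⊛ (g ⊛ h)) k + ((f ⊛ (∂ g ⊛ h)) k + (f ⊛ (g ⊛ ∂ h)) k)
    ≡⟨ cong₂ _+_ (⊛-assoc (∂ f) g h k) (cong₂ _+_ (⊛-assoc f (∂ g) h k) (⊛-assoc f g (∂ h) k)) ⟩
  ((∂ f ⊛ g) ⊛ h) k + (((f ⊛ ∂ g) ⊛ h) k + ((f ⊛ g) ⊛ ∂ h) k)
    ≡⟨ +-assoc (((∂ f ⊛ g) ⊛ h) k) _ _ ⟨
  ((∂ f ⊛ g) ⊛ h) k + ((f ⊛ ∂ g) ⊛ h) k + ((f ⊛ g) ⊛ ∂ h) k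
    ≡⟨ cong (_+ ((f ⊛ g) ⊛ ∂ h) k) (trans (⊛-congˡ (⊛-leibniz f g) h k)
                                          (⊛-distribʳ-⊕ (∂ f ⊛ g) (f ⊛ ∂ g) h k)) ⟨
  (∂ (f ⊛ g) ⊛ h) k + ((f ⊛ g) ⊛ ∂ h) k
    ≡⟨ ⊛-leibniz (f ⊛ g) h k ⟨
  ((f ⊛ g) ⊛ h) (suc k) ∎
  where open ≡-Reasoning

⊛-swap : ∀ f g h → f ⊛ (g ⊛ h) ≗ g ⊛ (f ⊛ h)
⊛-swap f g h k = begin
  (f ⊛ (g ⊛ h)) k  ≡⟨ ⊛-assoc f g h k ⟩
  ((f ⊛ g) ⊛ h) k  ≡⟨ ⊛-congˡ (⊛-comm f g) h k ⟩
  ((g ⊛ f) ⊛ h) k  ≡⟨ ⊛-assoc g f h k ⟨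
  (g ⊛ (f ⊛ h)) k  ∎
  where open ≡-Reasoning

⊛-identityʳ : ∀ f → f ⊛ δ ≗ f
⊛-identityʳ f zero    = trans (*-identityʳ _) (+-identityʳ (f 0))
⊛-identityʳ f (suc k) = begin
  (f ⊛ δ) (suc k)             ≡⟨ ⊛-leibniz f δ k ⟩
  (∂ f ⊛ δ) k + (f ⊛ ∂ δ) k
    ≡⟨ cong₂ _+_ (⊛-identityʳ (∂ f) k) (sumUpTo-cong k (λ i _ → *-zeroʳ (choose k i * f i))) ⟩
  f (suc k) + sumUpTo k (λ _ → 0)  ≡⟨ cong (f (suc k) +_) (sumUpTo-zero k) ⟩
  f (suc k) + 0               ≡⟨ +-identityʳ _ ⟩
  f (suc k)                   ∎
  where open ≡-Reasoning

⊛-identityˡ : ∀ f → δ ⊛ f ≗ f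
⊛-identityˡ f k = trans (⊛-comm δ f k) (⊛-identityʳ f k)

mulX-⊛ : ∀ f g → mulX f ⊛ g ≗ mulX (f ⊛ g)
mulX-⊛ f g zero    = refl
mulX-⊛ f g (suc k) = begin
  (mulX f ⊛ g) (suc k)
    ≡⟨ sumUpTo-unfoldˡ k _ ⟩
  1 * 0 * g (suc k) + sumUpTo k (λ i → choose (suc k) (suc i) * (suc i * f i) * g (k ∸ i))
    ≡⟨ sumUpTo-cong k (λ i _ → absorb i) ⟩
  sumUpTo k (λ i → suc k * (choose k i * f i * g (k ∸ i)))
    ≡⟨ sumUpTo-*ˡ k (suc k) _ ⟩
  suc k * (f ⊛ g) k ∎
  where
  open ≡-Reasoning
  absorb : ∀ i → choose (suc k) (suc i) * (suc i * f i) * g (k ∸ i) ≡ suc k * (choose k i * f i * g (k ∸ i))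
  absorb i = begin
    choose (suc k) (suc i) * (suc i * f i) * g (k ∸ i)
      ≡⟨ regroup (choose (suc k) (suc i)) (suc i) (f i) (g (k ∸ i)) ⟩
    suc i * choose (suc k) (suc i) * (f i * g (k ∸ i))
      ≡⟨ cong (_* (f i * g (k ∸ i))) (choose-absorb k i) ⟩
    suc k * choose k i * (f i * g (k ∸ i))
      ≡⟨ regroup′ (suc k) (choose k i) (f i) (g (k ∸ i)) ⟩
    suc k * (choose k i * f i * g (k ∸ i)) ∎
    where regroup : ∀ a b c d → a * (b * c) * d ≡ b * a * (c * d)
          regroup = solve-∀
          regroup′ : ∀ a b c d → a * b * (c * d) ≡ a * (b * c * d)
          regroup′ = solve-∀

mulX-cong : ∀ {f g} → f ≗ g → mulX f ≗ mulX g
mulX-cong f≗g zero    = refl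
mulX-cong f≗g (suc i) = cong (suc i *_) (f≗g i)

⊛-mulX : ∀ f g → f ⊛ mulX g ≗ mulX (f ⊛ g)
⊛-mulX f g k = trans (⊛-comm f (mulX g) k) (trans (mulX-⊛ g f k) (mulX-cong (⊛-comm g f) k))

dilate-⊛ : ∀ m f g → dilate m f ⊛ dilate m g ≗ dilate m (f ⊛ g)
dilate-⊛ m f g k = trans (sumUpTo-cong k collect) (sumUpTo-*ˡ k (m ^ k) _)
  where
  regroup : ∀ a b c d e → a * (b * c) * (d * e) ≡ b * d * (a * c * e)
  regroup = solve-∀
  collect : ∀ i → i ≤ k → choose k i * (m ^ i * f i) * (m ^ (k ∸ i) * g (k ∸ i))
                        ≡ m ^ k * (choose k i * f i * g (k ∸ i))
  collect i i≤k = trans (regroup (choose k i) (m ^ i) (f i) (m ^ (k ∸ i)) (g (k ∸ i)))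
    (cong (_* (choose k i * f i * g (k ∸ i)))
          (trans (sym (^-distribˡ-+-* m i (k ∸ i))) (cong (m ^_) (m+[n∸m]≡n i≤k))))

-- Words meeting prescribed parts

-- powers b x i counts length-i words over x letters, excluding the empty word when b = true;
-- words a R k counts length-k words over an alphabet with a_j letters of colour j that use
-- every colour j with R_j = true.
powers : Bool → ℕ → Seq
powers true  x zero    = 0
powers true  x (suc i) = x ^ suc i
powers false x i       = x ^ i

words : ∀ {r} → Vec ℕ r → Vec Bool r → Seq
words []       []       = δ
words (a ∷ as) (b ∷ bs) = powers b a ⊛ words as bs

onto : ∀ {r} → Vec ℕ r → Seq
onto a = words a (replicate _ true)

powers-suc : ∀ b a → powers b a ⊕ mulX (powers false a) ≤̇ powers b (suc a)
powers-suc true  a zero    = ≤-refl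
powers-suc false a zero    = ≤-refl
powers-suc true  a (suc i) = ^-bernoulli a i
powers-suc false a (suc i) = ^-bernoulli a i

-- A word over the enlarged alphabet avoids the new letter of part p, or uses it exactly once at one
-- of its positions (which meets part p), or uses it several times; the last kind is dropped.
words-inc : ∀ {r} (p : Fin r) a R → words a R ⊕ mulX (words a (R [ p ]≔ false)) ≤̇ words (a [ p ]%= suc) R
words-inc zero    (a ∷ as) (b ∷ R) k = begin
  (powers b a ⊛ words as R) k + mulX (powers false a ⊛ words as R) k
    ≡⟨ cong ((powers b a ⊛ words as R) k +_) (mulX-⊛ (powers false a) (words as R) k) ⟨
  (powers b a ⊛ words as R) k + (mulX (powers false a) ⊛ words as R) k
    ≡⟨ ⊛-distribʳ-⊕ (powers b a) (mulX (powers false a)) (words as R) k ⟨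
  ((powers b a ⊕ mulX (powers false a)) ⊛ words as R) k
    ≤⟨ ⊛-monoˡ-≤ (words as R) (powers-suc b a) k ⟩
  (powers b (suc a) ⊛ words as R) k ∎
  where open ≤-Reasoning
words-inc (suc q) (a ∷ as) (b ∷ R) k = begin
  (powers b a ⊛ words as R) k + mulX (powers b a ⊛ words as R′) k
    ≡⟨ cong ((powers b a ⊛ words as R) k +_) (⊛-mulX (powers b a) (words as R′) k) ⟨
  (powers b a ⊛ words as R) k + (powers b a ⊛ mulX (words as R′)) k
    ≡⟨ ⊛-distribˡ-⊕ (powers b a) (words as R) (mulX (words as R′)) k ⟨
  (powers b a ⊛ (words as R ⊕ mulX (words as R′))) k
    ≤⟨ ⊛-monoʳ-≤ (powers b a) (words-inc q as R) k ⟩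
  (powers b a ⊛ words (as [ q ]%= suc) R) k ∎
  where open ≤-Reasoning
        R′ = R [ q ]≔ false

powers-dilate : ∀ b m x → powers b (m * x) ≗ dilate m (powers b x)
powers-dilate true  m x zero    = refl
powers-dilate true  m x (suc i) = ^-distribʳ-* m x (suc i)
powers-dilate false m x i       = ^-distribʳ-* m x i

words-dilate : ∀ {r} m (a : Vec ℕ r) R → words (Vec.map (m *_) a) R ≗ dilate m (words a R)
words-dilate m []       [] zero    = refl
words-dilate m []       [] (suc k) = sym (*-zeroʳ (m ^ suc k))
words-dilate m (a ∷ as) (b ∷ R) k  =
  trans (⊛-cong (powers-dilate b m a) (words-dilate m as R) k) (dilate-⊛ m (powers b a) (words as R) k)

powers-binomial : ∀ x y → powers false x ⊛ powers false y ≗ powers false (x + y)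
powers-binomial x y zero    = refl
powers-binomial x y (suc k) = begin
  (powers false x ⊛ powers false y) (suc k)
    ≡⟨ ⊛-leibniz (powers false x) (powers false y) k ⟩
  (x · powers false x ⊛ powers false y) k + (powers false x ⊛ y · powers false y) k
    ≡⟨ cong₂ _+_ (·-⊛ x (powers false x) (powers false y) k) (⊛-· y (powers false x) (powers false y) k) ⟩
  x * (powers false x ⊛ powers false y) k + y * (powers false x ⊛ powers false y) k
    ≡⟨ *-distribʳ-+ _ x y ⟨
  (x + y) * (powers false x ⊛ powers false y) k
    ≡⟨ cong ((x + y) *_) (powers-binomial x y k) ⟩
  (x + y) ^ suc k ∎
  where open ≡-Reasoning

powers-false : ∀ x → powers false x ≗ powers true x ⊕ δ
powers-false x zero    = refl
powers-false x (suc i) = sym (+-identityʳ _)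

powers-true-⊛-expand : ∀ x y s →
  (powers true x ⊛ powers true y) s + (powers true x s + powers true y s) + δ s ≡ (x + y) ^ s
powers-true-⊛-expand x y s = begin
  (X ⊛ Y) s + (X s + Y s) + δ s       ≡⟨ regroup ((X ⊛ Y) s) (X s) (Y s) (δ s) ⟩
  ((X ⊛ Y) s + X s) + (Y s + δ s)
    ≡⟨ cong₂ _+_ (cong ((X ⊛ Y) s +_) (⊛-identityʳ X s)) (⊛-identityˡ (Y ⊕ δ) s) ⟨
  ((X ⊛ Y) s + (X ⊛ δ) s) + (δ ⊛ (Y ⊕ δ)) s
    ≡⟨ cong (_+ (δ ⊛ (Y ⊕ δ)) s) (⊛-distribˡ-⊕ X Y δ s) ⟨
  (X ⊛ (Y ⊕ δ)) s + (δ ⊛ (Y ⊕ δ)) s   ≡⟨ ⊛-distribʳ-⊕ X δ (Y ⊕ δ) s ⟨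
  ((X ⊕ δ) ⊛ (Y ⊕ δ)) s               ≡⟨ ⊛-cong (powers-false x) (powers-false y) s ⟨
  (powers false x ⊛ powers false y) s ≡⟨ powers-binomial x y s ⟩
  (x + y) ^ s                         ∎
  where
  open ≡-Reasoning
  X = powers true x
  Y = powers true y
  regroup : ∀ a b c d → a + (b + c) + d ≡ a + b + (c + d)
  regroup = solve-∀

-- Both pairs have the same expansion (x + y)^s, so the smaller single powers force the larger ⊛-term.
powers-true-⊛-balance : ∀ {x y n y′} → Between x y n → x + y ≡ n + y′ →
                        powers true x ⊛ powers true y ≤̇ powers true n ⊛ powers true y′
powers-true-⊛-balance {x} {y} {n} {y′} between eq s = +-cancelʳ-≤ (X s + Y s) _ _ (begin
  (X ⊛ Y) s + (X s + Y s)    ≡⟨ +-cancelʳ-≡ (δ s) _ _ same-expansion ⟩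
  (N ⊛ Y′) s + (N s + Y′ s)  ≤⟨ +-monoʳ-≤ ((N ⊛ Y′) s) (single-powers s) ⟩
  (N ⊛ Y′) s + (X s + Y s)   ∎)
  where
  open ≤-Reasoning
  X = powers true x
  Y = powers true y
  N = powers true n
  Y′ = powers true y′
  same-expansion : (X ⊛ Y) s + (X s + Y s) + δ s ≡ (N ⊛ Y′) s + (N s + Y′ s) + δ s
  same-expansion = trans (powers-true-⊛-expand x y s)
                         (trans (cong (_^ s) eq) (sym (powers-true-⊛-expand n y′ s)))
  single-powers : ∀ s → N s + Y′ s ≤ X s + Y s
  single-powers zero    = ≤-refl
  single-powers (suc s) = Between⇒^-balance between eq (suc s)

onto-exchange : ∀ {L} x n (bs : Vec ℕ L) i {y′} → Between x (lookup bs i) n → x + lookup bs i ≡ n + y′ →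
                onto (x ∷ bs) ≤̇ onto (n ∷ (bs [ i ]≔ y′))
onto-exchange x n (y ∷ bs) zero {y′} between eq k = begin
  (powers true x ⊛ (powers true y ⊛ onto bs)) k   ≡⟨ ⊛-assoc (powers true x) (powers true y) (onto bs) k ⟩
  ((powers true x ⊛ powers true y) ⊛ onto bs) k
    ≤⟨ ⊛-monoˡ-≤ (onto bs) (powers-true-⊛-balance between eq) k ⟩
  ((powers true n ⊛ powers true y′) ⊛ onto bs) k  ≡⟨ ⊛-assoc (powers true n) (powers true y′) (onto bs) k ⟨
  (powers true n ⊛ (powers true y′ ⊛ onto bs)) k  ∎
  where open ≤-Reasoning
onto-exchange x n (z ∷ bs) (suc i) {y′} between eq k = begin
  onto (x ∷ z ∷ bs) k                       ≡⟨ ⊛-swap (powers true x) (powers true z) (onto bs) k ⟩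
  (powers true z ⊛ onto (x ∷ bs)) k
    ≤⟨ ⊛-monoʳ-≤ (powers true z) (onto-exchange x n bs i between eq) k ⟩
  onto (z ∷ n ∷ (bs [ i ]≔ y′)) k           ≡⟨ ⊛-swap (powers true z) (powers true n) (onto (bs [ i ]≔ y′)) k ⟩
  onto (n ∷ z ∷ (bs [ i ]≔ y′)) k           ∎
  where open ≤-Reasoning

∃-entry-≥ : ∀ {L} n (bs : Vec ℕ L) → L * n < sum bs → ∃ λ i → n ≤ lookup bs i
∃-entry-≥ n (y ∷ bs) Ln<sum with n ≤? y
... | yes n≤y = zero , n≤y
... | no  n≰y with i , n≤ ← ∃-entry-≥ n bs (m<n∧n+a<m+b⇒a<b (≰⇒> n≰y) Ln<sum) = suc i , n≤

∃-entry-≤ : ∀ {L} n (bs : Vec ℕ L) → sum bs < L * n → ∃ λ i → lookup bs i ≤ n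
∃-entry-≤ n (y ∷ bs) sum<Ln with y ≤? n
... | yes y≤n = zero , y≤n
... | no  y≰n with i , ≤n ← ∃-entry-≤ n bs (m<n∧n+a<m+b⇒a<b (≰⇒> y≰n) sum<Ln) = suc i , ≤n

onto-rebalance : ∀ {L t} x n (bs : Vec ℕ L) i → Between x (lookup bs i) n → x + sum bs ≡ n + t →
                 ∃ λ cs → sum cs ≡ t × onto (x ∷ bs) ≤̇ onto (n ∷ cs)
onto-rebalance x n bs i between total =
  bs [ i ]≔ y′ , sum-[]≔-exchange x n bs i total pair , onto-exchange x n bs i between pair
  where
  y′ = x + lookup bs i ∸ n
  pair : x + lookup bs i ≡ n + y′
  pair = sym (m+[n∸m]≡n (Between⇒≤+ between))

onto-balance-step : ∀ {L} x n (bs : Vec ℕ L) → x + sum bs ≡ n + L * n →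
                    ∃ λ cs → sum cs ≡ L * n × onto (x ∷ bs) ≤̇ onto (n ∷ cs)
onto-balance-step x n bs total with <-cmp x n
... | tri≈ _ refl _ = bs , +-cancelˡ-≡ x _ _ total , λ _ → ≤-refl
... | tri< x<n _ _ with i , n≤y ← ∃-entry-≥ n bs (m<n∧m+a≡n+b⇒b<a x<n total) =
  onto-rebalance x n bs i (inj₁ (<⇒≤ x<n , n≤y)) total
... | tri> _ _ n<x with i , y≤n ← ∃-entry-≤ n bs (m<n∧m+a≡n+b⇒b<a n<x (sym total)) =
  onto-rebalance x n bs i (inj₂ (y≤n , <⇒≤ n<x)) total

onto-balance : ∀ L n (bs : Vec ℕ L) → sum bs ≡ L * n → onto bs ≤̇ onto (replicate L n)
onto-balance zero    n []       _     _ = ≤-refl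
onto-balance (suc L) n (x ∷ bs) total k with cs , sum≡ , ≤cs ← onto-balance-step x n bs total =
  ≤-trans (≤cs k) (⊛-monoʳ-≤ (powers true n) (onto-balance L n cs sum≡) k)

surjections : ℕ → Seq
surjections r = onto (replicate r 1)

∂-powers-true-1 : ∂ (powers true 1) ≗ powers true 1 ⊕ δ
∂-powers-true-1 zero    = refl
∂-powers-true-1 (suc i) = trans (^-zeroˡ (2 + i)) (sym (trans (+-identityʳ _) (^-zeroˡ (suc i))))

∂-surjections : ∀ r → ∂ (surjections (suc r)) ≗ suc r · (surjections (suc r) ⊕ surjections r)
∂-surjections zero    k = begin
  (powers true 1 ⊛ δ) (suc k)          ≡⟨ ⊛-identityʳ (powers true 1) (suc k) ⟩
  1 ^ suc k                            ≡⟨ ^-zeroˡ (suc k) ⟩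
  1                                    ≡⟨ ^-zeroˡ k ⟨
  1 ^ k                                ≡⟨ powers-false 1 k ⟩
  powers true 1 k + δ k                ≡⟨ cong (_+ δ k) (⊛-identityʳ (powers true 1) k) ⟨
  surjections 1 k + surjections 0 k    ≡⟨ *-identityˡ _ ⟨
  1 * (surjections 1 k + surjections 0 k) ∎
  where open ≡-Reasoning
∂-surjections (suc r) k = begin
  (powers true 1 ⊛ S₁) (suc k)
    ≡⟨ ⊛-leibniz (powers true 1) S₁ k ⟩
  (∂ (powers true 1) ⊛ S₁) k + (powers true 1 ⊛ ∂ S₁) k
    ≡⟨ cong₂ _+_ (⊛-congˡ ∂-powers-true-1 S₁ k) (⊛-congʳ (powers true 1) (∂-surjections r) k) ⟩
  ((powers true 1 ⊕ δ) ⊛ S₁) k + (powers true 1 ⊛ suc r · (S₁ ⊕ S₀)) k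
    ≡⟨ cong₂ _+_ (trans (⊛-distribʳ-⊕ (powers true 1) δ S₁ k) (cong (S₂ k +_) (⊛-identityˡ S₁ k)))
                 (trans (⊛-· (suc r) (powers true 1) (S₁ ⊕ S₀) k)
                        (cong (suc r *_) (⊛-distribˡ-⊕ (powers true 1) S₁ S₀ k))) ⟩
  (S₂ k + S₁ k) + suc r * (S₂ k + S₁ k) ∎
  where
  open ≡-Reasoning
  S₀ = surjections r
  S₁ = surjections (suc r)
  S₂ = surjections (2 + r)

surjections≡!*stirling₂ : ∀ r k → surjections r k ≡ r ! * stirling₂ k r
surjections≡!*stirling₂ zero    zero    = refl
surjections≡!*stirling₂ (suc r) zero    = sym (*-zeroʳ (suc r !))
surjections≡!*stirling₂ zero    (suc k) = refl
surjections≡!*stirling₂ (suc r) (suc k) = begin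
  surjections (suc r) (suc k)
    ≡⟨ ∂-surjections r k ⟩
  suc r * (surjections (suc r) k + surjections r k)
    ≡⟨ cong (suc r *_) (cong₂ _+_ (surjections≡!*stirling₂ (suc r) k) (surjections≡!*stirling₂ r k)) ⟩
  suc r * (suc r ! * stirling₂ k (suc r) + r ! * stirling₂ k r)
    ≡⟨ regroup (suc r) (r !) (stirling₂ k (suc r)) (stirling₂ k r) ⟩
  suc r ! * (suc r * stirling₂ k (suc r) + stirling₂ k r) ∎
  where open ≡-Reasoning
        regroup : ∀ s f a b → s * (s * f * a + f * b) ≡ s * f * (s * a + b)
        regroup = solve-∀

-- Scaling the parts by r makes their average the integer n, so balancing applies without fractions.
^*onto≤ : ∀ {r} n (a : Vec ℕ r) k → sum a ≡ n → r ^ k * onto a k ≤ n ^ k * (r ! * stirling₂ k r)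
^*onto≤ {r} n a k sum≡n = begin
  r ^ k * onto a k                          ≡⟨ words-dilate r a _ k ⟨
  onto (Vec.map (r *_) a) k
    ≤⟨ onto-balance r n (Vec.map (r *_) a) (trans (sum-map-* r a) (cong (r *_) sum≡n)) k ⟩
  onto (replicate r n) k                    ≡⟨ cong (λ b → onto b k) (replicate≡map-* r n) ⟩
  onto (Vec.map (n *_) (replicate r 1)) k   ≡⟨ words-dilate n (replicate r 1) _ k ⟩
  n ^ k * surjections r k                   ≡⟨ cong (n ^ k *_) (surjections≡!*stirling₂ r k) ⟩
  n ^ k * (r ! * stirling₂ k r)             ∎
  where open ≤-Reasoning

-- From crossing edges to words

count : ∀ {A : Set} → (A → Bool) → List A → ℕ
count p []       = 0
count p (x ∷ xs) = if p x then suc (count p xs) else count p xs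

count-++ : ∀ {A : Set} (p : A → Bool) xs ys → count p (xs ++ ys) ≡ count p xs + count p ys
count-++ p []       ys = refl
count-++ p (x ∷ xs) ys with p x
... | true  = cong suc (count-++ p xs ys)
... | false = count-++ p xs ys

count-map : ∀ {A B : Set} (p : B → Bool) (f : A → B) xs → count p (List.map f xs) ≡ count (p ∘ f) xs
count-map p f []       = refl
count-map p f (x ∷ xs) with p (f x)
... | true  = cong suc (count-map p f xs)
... | false = count-map p f xs

count-false : ∀ {A : Set} (xs : List A) → count (λ _ → false) xs ≡ 0
count-false []       = refl
count-false (x ∷ xs) = count-false xs

count-mono-≤ : ∀ {A : Set} {p q : A → Bool} → (∀ x → T (p x) → T (q x)) → ∀ xs → count p xs ≤ count q xs
count-mono-≤                 p⇒q []       = z≤n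
count-mono-≤ {p = p} {q} p⇒q (x ∷ xs) with p x in px | q x in qx
... | true  | true  = s≤s (count-mono-≤ p⇒q xs)
... | true  | false = ⊥-elim (subst T qx (p⇒q x (subst T (sym px) _)))
... | false | true  = m≤n⇒m≤1+n (count-mono-≤ p⇒q xs)
... | false | false = count-mono-≤ p⇒q xs

count-filter : ∀ {A : Set} {P : Pred A 0ℓ} (P? : Decidable P) (q : A → Bool) xs →
               count q (filter P? xs) ≡ count (λ x → does (P? x) ∧ q x) xs
count-filter P? q []       = refl
count-filter P? q (x ∷ xs) with does (P? x)
... | false = count-filter P? q xs
... | true  with q x
...   | true  = cong suc (count-filter P? q xs)
...   | false = count-filter P? q xs

length-filter≡count : ∀ {A : Set} {P : Pred A 0ℓ} (P? : Decidable P) xs →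
                      length (filter P? xs) ≡ count (does ∘ P?) xs
length-filter≡count P? []       = refl
length-filter≡count P? (x ∷ xs) with does (P? x)
... | true  = cong suc (length-filter≡count P? xs)
... | false = length-filter≡count P? xs

count-allSubsets-suc : ∀ n (p : Subset (suc n) → Bool) →
  count p (allSubsets (suc n)) ≡ count (p ∘ (true ∷_)) (allSubsets n) + count (p ∘ (false ∷_)) (allSubsets n)
count-allSubsets-suc n p = trans (count-++ p (List.map (true ∷_) (allSubsets n)) _)
  (cong₂ _+_ (count-map p (true ∷_) (allSubsets n)) (count-map p (false ∷_) (allSubsets n)))

hasSize : ∀ {n} → ℕ → Subset n → Bool
hasSize k e = does (∣ e ∣ ≟ k)

count-hasSize : ∀ n k → count (hasSize k) (allSubsets n) ≡ choose n k
count-hasSize zero    zero    = refl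
count-hasSize zero    (suc k) = refl
count-hasSize (suc n) zero    =
  trans (count-allSubsets-suc n (hasSize 0)) (cong₂ _+_ (count-false (allSubsets n)) (count-hasSize n 0))
count-hasSize (suc n) (suc k) =
  trans (count-allSubsets-suc n (hasSize (suc k))) (cong₂ _+_ (count-hasSize n k) (count-hasSize n (suc k)))

numEdges≡choose : ∀ n k → numEdges n k ≡ choose n k
numEdges≡choose n k = trans (length-filter≡count (λ e → ∣ e ∣ ≟ k) (allSubsets n)) (count-hasSize n k)

noneRequired : ∀ {r} → Vec Bool r → Bool
noneRequired []      = true
noneRequired (b ∷ R) = not b ∧ noneRequired R

-- R marks the parts still to be met; a vertex of e clears the mark of its part.
covers : ∀ {n r} → Cut n r → Vec Bool r → Subset n → Bool
covers {zero}  c R []          = noneRequired R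
covers {suc n} c R (true ∷ e)  = covers (c ∘ suc) (R [ c zero ]≔ false) e
covers {suc n} c R (false ∷ e) = covers (c ∘ suc) R e

noneRequired-complete : ∀ {r} (R : Vec Bool r) → (∀ j → lookup R j ≢ true) → T (noneRequired R)
noneRequired-complete []          none = _
noneRequired-complete (true  ∷ R) none = ⊥-elim (none zero refl)
noneRequired-complete (false ∷ R) none = noneRequired-complete R (none ∘ suc)

covers-complete : ∀ {n r} (c : Cut n r) R e → (∀ j → lookup R j ≡ true → ∃ λ v → v ∈ e × c v ≡ j) →
                  T (covers c R e)
covers-complete {zero}  c R []          meets = noneRequired-complete R (λ j Rj → nowhere (meets j Rj))
  where nowhere : ∀ {j} → ∃ (λ (v : Fin 0) → v ∈ [] × c v ≡ j) → ⊥
        nowhere (() , _)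
covers-complete {suc n} c R (true ∷ e)  meets = covers-complete (c ∘ suc) (R [ c zero ]≔ false) e meets′
  where
  meets′ : ∀ j → lookup (R [ c zero ]≔ false) j ≡ true → ∃ λ v → v ∈ e × c (suc v) ≡ j
  meets′ j Rj with c zero ≟ᶠ j
  ... | yes refl = ⊥-elim (false≢true (trans (sym (lookup∘update (c zero) R false)) Rj))
    where false≢true : false ≢ true
          false≢true ()
  ... | no c0≢j with meets j (trans (sym (lookup∘update′ (c0≢j ∘ sym) R false)) Rj)
  ...   | zero  , _    , c0≡j = ⊥-elim (c0≢j c0≡j)
  ...   | suc v , v∈e , cv≡j = v , drop-there v∈e , cv≡j
covers-complete {suc n} c R (false ∷ e) meets = covers-complete (c ∘ suc) R e meets′
  where
  meets′ : ∀ j → lookup R j ≡ true → ∃ λ v → v ∈ e × c (suc v) ≡ j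
  meets′ j Rj with meets j Rj
  ... | zero  , ()  , _
  ... | suc v , v∈e , cv≡j = v , drop-there v∈e , cv≡j

covering : ∀ n {r} → Cut n r → ℕ → Vec Bool r → ℕ
covering n c k R = count (λ e → hasSize k e ∧ covers c R e) (allSubsets n)

cutSize≤covering : ∀ n {r} (c : Cut n r) k → cutSize k c ≤ covering n c k (replicate r true)
cutSize≤covering n {r} c k = begin
  cutSize k c
    ≡⟨ length-filter≡count (crossing? c) (edges n k) ⟩
  count (does ∘ crossing? c) (edges n k)
    ≡⟨ count-filter (λ e → ∣ e ∣ ≟ k) (does ∘ crossing? c) (allSubsets n) ⟩
  count (λ e → hasSize k e ∧ does (crossing? c e)) (allSubsets n)
    ≤⟨ count-mono-≤ crossing⇒covers (allSubsets n) ⟩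
  covering n c k (replicate r true) ∎
  where
  open ≤-Reasoning
  crossing⇒covers : ∀ e → T (hasSize k e ∧ does (crossing? c e)) →
                    T (hasSize k e ∧ covers c (replicate r true) e)
  crossing⇒covers e t with hasSize k e
  ... | true = covers-complete c _ e (λ j _ → toWitness (subst T (sym (isYes≗does (crossing? c e))) t) j)

partSizes : ∀ {n r} → Cut n r → Vec ℕ r
partSizes {zero}  c = replicate _ 0
partSizes {suc n} c = partSizes (c ∘ suc) [ c zero ]%= suc

sum-partSizes : ∀ n {r} (c : Cut n r) → sum (partSizes c) ≡ n
sum-partSizes zero    {r} c = sum-replicate-0 r
sum-partSizes (suc n)     c =
  trans (sum-[]%=suc (partSizes (c ∘ suc)) (c zero)) (cong suc (sum-partSizes n (c ∘ suc)))

words-noneRequired : ∀ {r} (a : Vec ℕ r) R → T (noneRequired R) → words a R 0 ≡ 1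
words-noneRequired []       []          _    = refl
words-noneRequired (a ∷ as) (false ∷ R) none = trans (*-identityˡ _) (words-noneRequired as R none)

-- Listing a covering k-set in each of its k! orders gives distinct words that use every required part.
k!*covering≤words : ∀ n {r} (c : Cut n r) k R → k ! * covering n c k R ≤ words (partSizes c) R k
k!*covering≤words zero    c (suc k) R = subst (_≤ words (partSizes c) R (suc k)) (sym (*-zeroʳ (suc k !))) z≤n
k!*covering≤words zero    c zero    R with noneRequired R in none
... | false = z≤n
... | true  = ≤-reflexive (sym (words-noneRequired (replicate _ 0) R (subst T (sym none) _)))
k!*covering≤words (suc n) c zero    R = begin
  1 * covering (suc n) c 0 R
    ≡⟨ cong (1 *_) (trans (count-allSubsets-suc n _)
                          (cong (_+ covering n (c ∘ suc) 0 R) (count-false (allSubsets n)))) ⟩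
  1 * covering n (c ∘ suc) 0 R     ≤⟨ k!*covering≤words n (c ∘ suc) 0 R ⟩
  words a R 0                      ≡⟨ +-identityʳ _ ⟨
  words a R 0 + mulX (words a (R [ c zero ]≔ false)) 0 ≤⟨ words-inc (c zero) a R 0 ⟩
  words (partSizes c) R 0          ∎
  where open ≤-Reasoning
        a = partSizes (c ∘ suc)
k!*covering≤words (suc n) c (suc k) R = begin
  suc k ! * covering (suc n) c (suc k) R
    ≡⟨ cong (suc k ! *_) (count-allSubsets-suc n _) ⟩
  (suc k * k !) * (containing₀ + avoiding₀)
    ≡⟨ distrib (suc k) (k !) containing₀ avoiding₀ ⟩
  suc k * (k ! * containing₀) + suc k ! * avoiding₀
    ≤⟨ +-mono-≤ (*-monoʳ-≤ (suc k) (k!*covering≤words n (c ∘ suc) k R′))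
                (k!*covering≤words n (c ∘ suc) (suc k) R) ⟩
  suc k * words a R′ k + words a R (suc k)
    ≡⟨ +-comm _ (words a R (suc k)) ⟩
  words a R (suc k) + mulX (words a R′) (suc k)
    ≤⟨ words-inc (c zero) a R (suc k) ⟩
  words (partSizes c) R (suc k) ∎
  where
  open ≤-Reasoning
  a = partSizes (c ∘ suc)
  R′ = R [ c zero ]≔ false
  containing₀ = covering n (c ∘ suc) k R′
  avoiding₀ = covering n (c ∘ suc) (suc k) R
  distrib : ∀ s f x y → (s * f) * (x + y) ≡ s * (f * x) + (s * f) * y
  distrib = solve-∀

fallingFactorial : ℕ → ℕ → ℕ
fallingFactorial n       zero    = 1
fallingFactorial zero    (suc k) = 0
fallingFactorial (suc n) (suc k) = suc n * fallingFactorial n k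

fallingFactorial-suc : ∀ n k → fallingFactorial n (suc k) + k * fallingFactorial n k ≡ n * fallingFactorial n k
fallingFactorial-suc zero    zero    = refl
fallingFactorial-suc zero    (suc k) = *-zeroʳ (suc k)
fallingFactorial-suc (suc n) zero    = +-identityʳ _
fallingFactorial-suc (suc n) (suc k) = begin
  suc n * F (suc k) + suc k * (suc n * F k)   ≡⟨ regroup (suc n) (F (suc k)) k (F k) ⟩
  suc n * ((F (suc k) + k * F k) + F k)       ≡⟨ cong (λ x → suc n * (x + F k)) (fallingFactorial-suc n k) ⟩
  suc n * (n * F k + F k)                     ≡⟨ cong (suc n *_) (+-comm (n * F k) (F k)) ⟩
  suc n * (suc n * F k)                       ∎
  where
  open ≡-Reasoning
  F = fallingFactorial n
  regroup : ∀ a b k c → a * b + (1 + k) * (a * c) ≡ a * ((b + k * c) + c)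
  regroup = solve-∀

k!*choose≡fallingFactorial : ∀ n k → k ! * choose n k ≡ fallingFactorial n k
k!*choose≡fallingFactorial n       zero    = refl
k!*choose≡fallingFactorial zero    (suc k) = *-zeroʳ (suc k !)
k!*choose≡fallingFactorial (suc n) (suc k) = begin
  (suc k * k !) * (choose n k + choose n (suc k))
    ≡⟨ distrib (suc k) (k !) (choose n k) (choose n (suc k)) ⟩
  suc k * (k ! * choose n k) + suc k ! * choose n (suc k)
    ≡⟨ cong₂ _+_ (cong (suc k *_) (k!*choose≡fallingFactorial n k)) (k!*choose≡fallingFactorial n (suc k)) ⟩
  suc k * F k + F (suc k)   ≡⟨ regroup k (F k) (F (suc k)) ⟩
  F k + (F (suc k) + k * F k) ≡⟨ cong (F k +_) (fallingFactorial-suc n k) ⟩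
  suc n * F k               ∎
  where
  open ≡-Reasoning
  F = fallingFactorial n
  distrib : ∀ s f x y → (s * f) * (x + y) ≡ s * (f * x) + (s * f) * y
  distrib = solve-∀
  regroup : ∀ k a b → (1 + k) * a + b ≡ a + (b + k * a)
  regroup = solve-∀

fallingFactorial≤^ : ∀ n k → fallingFactorial n k ≤ n ^ k
fallingFactorial≤^ n zero    = ≤-refl
fallingFactorial≤^ n (suc k) = begin
  fallingFactorial n (suc k)                                   ≤⟨ m≤m+n _ (k * fallingFactorial n k) ⟩
  fallingFactorial n (suc k) + k * fallingFactorial n k       ≡⟨ fallingFactorial-suc n k ⟩
  n * fallingFactorial n k                                     ≤⟨ *-monoʳ-≤ n (fallingFactorial≤^ n k) ⟩
  n ^ suc k                                                    ∎
  where open ≤-Reasoning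

^≤fallingFactorial+choose₂ : ∀ n k → n ^ suc k ≤ fallingFactorial n (suc k) + choose (suc k) 2 * n ^ k
^≤fallingFactorial+choose₂ n zero    = ≤-reflexive (sym (fallingFactorial-suc n 0))
^≤fallingFactorial+choose₂ n (suc k) = begin
  n * n ^ suc k                                     ≤⟨ *-monoʳ-≤ n (^≤fallingFactorial+choose₂ n k) ⟩
  n * (F (suc k) + c * n ^ k)                       ≡⟨ *-distribˡ-+ n (F (suc k)) _ ⟩
  n * F (suc k) + n * (c * n ^ k)                   ≡⟨ cong₂ _+_ (fallingFactorial-suc n (suc k)) (swap c n (n ^ k)) ⟨
  F (2 + k) + suc k * F (suc k) + c * n ^ suc k
    ≤⟨ +-monoˡ-≤ _ (+-monoʳ-≤ (F (2 + k)) (*-monoʳ-≤ (suc k) (fallingFactorial≤^ n (suc k)))) ⟩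
  F (2 + k) + suc k * n ^ suc k + c * n ^ suc k     ≡⟨ +-assoc (F (2 + k)) _ _ ⟩
  F (2 + k) + (suc k * n ^ suc k + c * n ^ suc k)   ≡⟨ cong (F (2 + k) +_) (*-distribʳ-+ (n ^ suc k) (suc k) c) ⟨
  F (2 + k) + (suc k + c) * n ^ suc k
    ≡⟨ cong (λ x → F (2 + k) + (x + c) * n ^ suc k) (choose-1 (suc k)) ⟨
  F (2 + k) + choose (2 + k) 2 * n ^ suc k          ∎
  where
  open ≤-Reasoning
  F = fallingFactorial n
  c = choose (suc k) 2
  swap : ∀ a b c → a * (b * c) ≡ b * (a * c)
  swap = solve-∀

k!*numEdges≡fallingFactorial : ∀ n k → k ! * numEdges n k ≡ fallingFactorial n k
k!*numEdges≡fallingFactorial n k = trans (cong (k ! *_) (numEdges≡choose n k)) (k!*choose≡fallingFactorial n k)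

^≤k!*numEdges+choose₂ : ∀ n k → n ^ suc k ≤ suc k ! * numEdges n (suc k) + choose (suc k) 2 * n ^ k
^≤k!*numEdges+choose₂ n k = subst (λ F → n ^ suc k ≤ F + choose (suc k) 2 * n ^ k)
  (sym (k!*numEdges≡fallingFactorial n (suc k))) (^≤fallingFactorial+choose₂ n k)

k!*r^k*cutSize≤ : ∀ {n r} k (c : Cut n r) → k ! * (r ^ k * cutSize k c) ≤ n ^ k * (r ! * stirling₂ k r)
k!*r^k*cutSize≤ {n} {r} k c = begin
  k ! * (q * cutSize k c)           ≤⟨ *-monoʳ-≤ (k !) (*-monoʳ-≤ q (cutSize≤covering n c k)) ⟩
  k ! * (q * N)                     ≡⟨ swap (k !) q N ⟩
  q * (k ! * N)                     ≤⟨ *-monoʳ-≤ q (k!*covering≤words n c k _) ⟩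
  q * onto (partSizes c) k          ≤⟨ ^*onto≤ n (partSizes c) k (sum-partSizes n c) ⟩
  n ^ k * (r ! * stirling₂ k r)     ∎
  where
  open ≤-Reasoning
  q = r ^ k
  N = covering n c k (replicate r true)
  swap : ∀ a b c → a * (b * c) ≡ b * (a * c)
  swap = solve-∀

cutSize-bound : ∀ {n r} k (c : Cut n r) →
  r ^ suc k * cutSize (suc k) c ≤
    stirling₂ (suc k) r * r ! * numEdges n (suc k) + stirling₂ (suc k) r * r ! * choose (suc k) 2 * n ^ k
cutSize-bound {n} {r} k c = *-cancelˡ-≤ K! {{suc k !≢0}} (begin
  K! * (r ^ suc k * cutSize (suc k) c)       ≤⟨ k!*r^k*cutSize≤ (suc k) c ⟩
  n ^ suc k * (r ! * S)                      ≤⟨ *-monoˡ-≤ (r ! * S) (^≤k!*numEdges+choose₂ n k) ⟩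
  (K! * m + C₂ * n ^ k) * (r ! * S)          ≡⟨ expand K! m (C₂ * n ^ k) (r !) S ⟩
  K! * (A * m) + A * (C₂ * n ^ k)            ≤⟨ +-monoʳ-≤ (K! * (A * m)) (m≤n*m _ K! {{suc k !≢0}}) ⟩
  K! * (A * m) + K! * (A * (C₂ * n ^ k))     ≡⟨ collect K! A m C₂ (n ^ k) ⟩
  K! * (A * m + A * C₂ * n ^ k)              ∎)
  where
  open ≤-Reasoning
  K! = suc k !
  S  = stirling₂ (suc k) r
  A  = S * r !
  m  = numEdges n (suc k)
  C₂ = choose (suc k) 2
  expand : ∀ f m y g s → (f * m + y) * (g * s) ≡ f * (s * g * m) + s * g * y
  expand = solve-∀
  collect : ∀ f a m c y → f * (a * m) + f * (a * (c * y)) ≡ f * (a * m + a * c * y)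
  collect = solve-∀

toℚᵘ-/ : ∀ i d .{{_ : NonZero d}} → toℚᵘ (ℤ.+ i ℚ./ d) ≃ᵘ mkℚᵘ (ℤ.+ i) (pred d)
toℚᵘ-/ i (suc d) = ℚ.toℚᵘ-fromℚᵘ (mkℚᵘ (ℤ.+ i) d)

/-sub-/-≤-* : ∀ x a b c q .{{_ : NonZero q}} → x * q ≤ a + b * c * q →
              (ℤ.+ x ℚ./ 1) ℚ.- (ℤ.+ a ℚ./ q) ℚ.≤ (ℤ.+ b ℚ./ 1) ℚ.* (ℤ.+ c ℚ./ 1)
/-sub-/-≤-* x a b c q@(suc d) x*q≤ = ℚ.toℚᵘ-cancel-≤ (begin
  toℚᵘ ((ℤ.+ x ℚ./ 1) ℚ.- (ℤ.+ a ℚ./ q))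
    ≃⟨ ℚᵘ.≃-trans (ℚ.toℚᵘ-homo-+ (ℤ.+ x ℚ./ 1) _) (ℚᵘ.+-cong (toℚᵘ-/ x 1) negated) ⟩
  mkℚᵘ (ℤ.+ x) 0 ℚᵘ.- mkℚᵘ (ℤ.+ a) d
    ≤⟨ *≤* (subst₂ ℤ._≤_ (sym lhs-num) (sym rhs-num) cross) ⟩
  mkℚᵘ (ℤ.+ b) 0 ℚᵘ.* mkℚᵘ (ℤ.+ c) 0
    ≃⟨ ℚᵘ.≃-trans (ℚ.toℚᵘ-homo-* (ℤ.+ b ℚ./ 1) _) (ℚᵘ.*-cong (toℚᵘ-/ b 1) (toℚᵘ-/ c 1)) ⟨
  toℚᵘ ((ℤ.+ b ℚ./ 1) ℚ.* (ℤ.+ c ℚ./ 1)) ∎)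
  where
  open ℚᵘ.≤-Reasoning
  negated : toℚᵘ (ℚ.- (ℤ.+ a ℚ./ q)) ≃ᵘ ℚᵘ.- mkℚᵘ (ℤ.+ a) d
  negated = ℚᵘ.≃-trans (ℚ.toℚᵘ-homo‿- (ℤ.+ a ℚ./ q)) (ℚᵘ.-‿cong (toℚᵘ-/ a q))
  lhs-num : (ℤ.+ x ℤ.* ℤ.+ q ℤ.+ ℤ.- (ℤ.+ a) ℤ.* ℤ.+ 1) ℤ.* ℤ.+ 1 ≡ ℤ.+ (x * q) ℤ.- ℤ.+ a
  lhs-num = trans (unit (ℤ.+ x) (ℤ.+ q) (ℤ.+ a)) (cong (ℤ._- ℤ.+ a) (sym (ℤ.pos-* x q)))
    where unit : ∀ X Q A → (X ℤ.* Q ℤ.+ ℤ.- A ℤ.* ℤ.+ 1) ℤ.* ℤ.+ 1 ≡ X ℤ.* Q ℤ.- A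
          unit = ℤ.solve-∀
  rhs-num : (ℤ.+ b ℤ.* ℤ.+ c) ℤ.* ℤ.+ (1 * q) ≡ ℤ.+ (b * c * q)
  rhs-num = trans (cong (λ z → (ℤ.+ b ℤ.* ℤ.+ c) ℤ.* ℤ.+ z) (*-identityˡ q))
              (trans (cong (ℤ._* ℤ.+ q) (sym (ℤ.pos-* b c))) (sym (ℤ.pos-* (b * c) q)))
  cancel : ∀ a y → ℤ.+ (a + y) ℤ.- ℤ.+ a ≡ ℤ.+ y
  cancel a y = trans (cong (ℤ._- ℤ.+ a) (ℤ.pos-+ a y)) (drop (ℤ.+ a) (ℤ.+ y))
    where drop : ∀ A Y → A ℤ.+ Y ℤ.- A ≡ Y
          drop = ℤ.solve-∀
  cross : ℤ.+ (x * q) ℤ.- ℤ.+ a ℤ.≤ ℤ.+ (b * c * q)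
  cross = subst (ℤ.+ (x * q) ℤ.- ℤ.+ a ℤ.≤_) (cancel a (b * c * q)) (ℤ.+-monoˡ-≤ (ℤ.- ℤ.+ a) (ℤ.+≤+ x*q≤))

lemma2p1 : (k r : ℕ) → 2 ≤ r → r ≤ k →
    ∃ λ (C : ℚ) → (n : ℕ) → (c : Cut n r) →
      excess k c ℚ.≤ C ℚ.* (ℤ.+ (n ^ (k ∸ 1)) ℚ./ 1)
lemma2p1 zero    (suc (suc _)) _ ()
lemma2p1 (suc k) (suc r)       _ _ = ℤ.+ (A * C₂) ℚ./ 1 , bound
  where
  A  = stirling₂ (suc k) (suc r) * suc r !
  C₂ = choose (suc k) 2
  q  = suc r ^ suc k
  instance
    q≢0 : NonZero q
    q≢0 = m^n≢0 (suc r) (suc k)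
  bound : ∀ n (c : Cut n (suc r)) → excess (suc k) c ℚ.≤ (ℤ.+ (A * C₂) ℚ./ 1) ℚ.* (ℤ.+ (n ^ k) ℚ./ 1)
  bound n c = /-sub-/-≤-* x (A * numEdges n (suc k)) (A * C₂) (n ^ k) q (begin
    x * q                                        ≡⟨ *-comm x q ⟩
    q * x                                        ≤⟨ cutSize-bound k c ⟩
    A * numEdges n (suc k) + A * C₂ * n ^ k      ≤⟨ +-monoʳ-≤ _ (m≤m*n (A * C₂ * n ^ k) q) ⟩
    A * numEdges n (suc k) + A * C₂ * n ^ k * q  ∎)
    where open ≤-Reasoning
          x = cutSize (suc k) c
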